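{- Let $\mathcal{RL}$ be the variety of residuated lattices, $\mathcal{GM}$ its subvariety of Girard monoids (residuated lattices satisfying $\neg\neg x = x$), $\mathcal{DRL}$ its subvariety of distributive residuated lattices (satisfying $x\wedge(y\vee z)=(x\wedge y)\vee(x\wedge z)$), and $\mathcal{DGM} = \mathcal{GM}\cap\mathcal{DRL}$. In each of the varieties $\mathcal{RL}$, $\mathcal{GM}$, $\mathcal{DRL}$, $\mathcal{DGM}$, every absolute retract and every injective algebra is trivial (has exactly one element).
   Context: A residuated lattice is an algebra $\langle A,\wedge,\vee,\odot,\rightarrow,0,1\rangle$ of type $\langle 2,2,2,2,0,0\rangle$ such that $\langle A,\odot,1\rangle$ is a commutative monoid, $\langle A,\vee,\wedge,0,1\rangle$ is a bounded lattice (with order $\le$), and for all $a,b,c\in A$: $a\odot b\le c$ iff $a\le b\rightarrow c$. Put $\neg x = x\rightarrow 0$. Homomorphisms preserve all operations, including the constants $0,1$. For a class $\mathcal K$ of algebras, $A\in\mathcal K$ is injective in $\mathcal K$ if for every injective homomorphism $f:B\to C$ with $B,C\in\mathcal K$ and every homomorphism $g:B\to A$ there is a homomorphism $h:C\to A$ with $h\circ f=g$. $A\in\mathcal K$ is an absolute retract in $\mathcal K$ if for every $B\in\mathcal K$ and every injective homomorphism $i:A\to B$ there is a homomorphism $r:B\to A$ with $r\circ i=1_A$. -}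

module Defs where

open import Level using (Level; _⊔_) renaming (suc to lsuc)
open import Data.Product using (_×_; Σ; _,_)
open import Data.Unit.Polymorphic using (⊤)
open import Function.Definitions using (Injective)
open import Relation.Binary.PropositionalEquality using (_≡_)
open import Algebra.Core using (Op₂)
open import Algebra.Structures using (IsCommutativeMonoid)
open import Algebra.Lattice.Structures using (IsLattice)

record ResLattice (ℓ : Level) : Set (lsuc ℓ) where
  infixr 7 _⊙_
  infixr 6 _∧_
  infixr 5 _∨_
  infixr 4 _⇒_
  field
    Carrier : Set ℓ
    _∧_ _∨_ _⊙_ _⇒_ : Op₂ Carrier
    𝟘 𝟙 : Carrier
    isCommutativeMonoid : IsCommutativeMonoid _≡_ _⊙_ 𝟙
    isLattice : IsLattice _≡_ _∨_ _∧_
    𝟘-least    : ∀ x → 𝟘 ∧ x ≡ 𝟘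
    𝟙-greatest : ∀ x → x ∧ 𝟙 ≡ x
    -- residuation: a ⊙ b ≤ c iff a ≤ b → c
    residuation₁ : ∀ a b c → (a ⊙ b) ∧ c ≡ a ⊙ b → a ∧ (b ⇒ c) ≡ a
    residuation₂ : ∀ a b c → a ∧ (b ⇒ c) ≡ a → (a ⊙ b) ∧ c ≡ a ⊙ b

  _≤_ : Carrier → Carrier → Set ℓ
  x ≤ y = x ∧ y ≡ x

  ¬_ : Carrier → Carrier
  ¬ x = x ⇒ 𝟘

open ResLattice

IsGirard : ∀ {ℓ} → ResLattice ℓ → Set ℓ
IsGirard A = ∀ x → (¬_ A (¬_ A x)) ≡ x

IsDistributive : ∀ {ℓ} → ResLattice ℓ → Set ℓ
IsDistributive A = ∀ x y z → _∧_ A x (_∨_ A y z) ≡ _∨_ A (_∧_ A x y) (_∧_ A x z)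

record Hom {ℓ₁ ℓ₂} (A : ResLattice ℓ₁) (B : ResLattice ℓ₂) : Set (ℓ₁ ⊔ ℓ₂) where
  field
    ⟦_⟧ : Carrier A → Carrier B
    pres-∧ : ∀ x y → ⟦ _∧_ A x y ⟧ ≡ _∧_ B ⟦ x ⟧ ⟦ y ⟧
    pres-∨ : ∀ x y → ⟦ _∨_ A x y ⟧ ≡ _∨_ B ⟦ x ⟧ ⟦ y ⟧
    pres-⊙ : ∀ x y → ⟦ _⊙_ A x y ⟧ ≡ _⊙_ B ⟦ x ⟧ ⟦ y ⟧
    pres-⇒ : ∀ x y → ⟦ _⇒_ A x y ⟧ ≡ _⇒_ B ⟦ x ⟧ ⟦ y ⟧
    pres-𝟘 : ⟦ 𝟘 A ⟧ ≡ 𝟘 B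
    pres-𝟙 : ⟦ 𝟙 A ⟧ ≡ 𝟙 B

open Hom

IsInjectiveHom : ∀ {ℓ₁ ℓ₂} {A : ResLattice ℓ₁} {B : ResLattice ℓ₂} → Hom A B → Set (ℓ₁ ⊔ ℓ₂)
IsInjectiveHom f = Injective _≡_ _≡_ ⟦ f ⟧

data Variety : Set where
  RL GM DRL DGM : Variety

_∈ᵥ_ : ∀ {ℓ} → ResLattice ℓ → Variety → Set ℓ
A ∈ᵥ RL  = ⊤
A ∈ᵥ GM  = IsGirard A
A ∈ᵥ DRL = IsDistributive A
A ∈ᵥ DGM = IsGirard A × IsDistributive A

-- A is injective in K (the algebras B, C range over K within the same universe level as A).
InjectiveIn : ∀ {ℓ} → Variety → ResLattice ℓ → Set (lsuc ℓ)
InjectiveIn {ℓ} K A =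
  (B C : ResLattice ℓ) → B ∈ᵥ K → C ∈ᵥ K →
  (f : Hom B C) → IsInjectiveHom f → (g : Hom B A) →
  Σ (Hom C A) λ h → ∀ x → ⟦ h ⟧ (⟦ f ⟧ x) ≡ ⟦ g ⟧ x

AbsoluteRetractIn : ∀ {ℓ} → Variety → ResLattice ℓ → Set (lsuc ℓ)
AbsoluteRetractIn {ℓ} K A =
  (B : ResLattice ℓ) → B ∈ᵥ K →
  (i : Hom A B) → IsInjectiveHom i →
  Σ (Hom B A) λ r → ∀ x → ⟦ r ⟧ (⟦ i ⟧ x) ≡ x

-- trivial: exactly one element (the carrier is inhabited by 0)
Trivial : ∀ {ℓ} → ResLattice ℓ → Set ℓ
Trivial A = (x y : Carrier A) → x ≡ y

-- Embed A diagonally, a ↦ [a, a], into the residuated lattice of intervals [a, b] (a ≤ b) with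
-- [a, b] ⊙ [c, d] = [a ⊙ c, a ⊙ d ∨ b ⊙ c]; it is a Girard monoid, or distributive, whenever A is.
-- An interval with lower end 𝟘 squares to 𝟘, and the biresiduum e = [𝟘, 𝟙] ⇔ [a, a] is one.
-- A retraction r with r [𝟘, 𝟙] = a sends e to a ⇔ a = 𝟙, hence 𝟙 = r (e ⊙ e) = r 𝟘 = 𝟘.
-- Injective algebras are absolute retracts, so both kinds are trivial.
module Submission where

open import Defs
open import Level using (Level)
open import Data.Product using (_×_; _,_; uncurry)
open import Data.Unit.Polymorphic using (tt)
open import Relation.Binary.PropositionalEquality using (_≡_; refl; sym; trans; cong; cong₂; isEquivalence; module ≡-Reasoning)
open import Axiom.UniquenessOfIdentityProofs.WithK using (uip)
open import Algebra.Structures using (IsCommutativeMonoid)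
open import Algebra.Lattice.Structures using (IsLattice)
open import Algebra.Lattice.Bundles using (Lattice)
import Algebra.Lattice.Properties.Lattice as LatticeProperties
import Relation.Binary.Lattice as OrderTheoretic
import Relation.Binary.Lattice.Properties.JoinSemilattice as JoinSemilatticeProperties
import Relation.Binary.Lattice.Properties.MeetSemilattice as MeetSemilatticeProperties
import Relation.Binary.Reasoning.PartialOrder as PosetReasoning
open Hom using (⟦_⟧; pres-⊙; pres-⇒; pres-𝟘)

module Properties {ℓ} (A : ResLattice ℓ) where
  open ResLattice A hiding (_≤_)
  open IsCommutativeMonoid isCommutativeMonoid public using ()
    renaming (assoc to ⊙-assoc; comm to ⊙-comm; identityˡ to ⊙-identityˡ; identityʳ to ⊙-identityʳ)
  open IsLattice isLattice public
    using (∧-comm; ∧-assoc; ∨-comm; ∨-assoc; ∨-absorbs-∧; ∧-absorbs-∨)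

  lattice : Lattice ℓ ℓ
  lattice = record { isLattice = isLattice }

  open LatticeProperties lattice public using (∧-idem; ∨-idem)

  -- The standard library's order x ≡ x ∧ y, i.e. ResLattice's x ≤ y with the equation flipped.
  open OrderTheoretic.Lattice (LatticeProperties.∨-∧-orderTheoreticLattice lattice) public
    using (_≤_; poset; x≤x∨y; y≤x∨y; ∨-least; x∧y≤x; x∧y≤y; ∧-greatest; joinSemilattice; meetSemilattice)
    renaming (refl to ≤-refl; reflexive to ≤-reflexive; trans to ≤-trans; antisym to ≤-antisym)
  open JoinSemilatticeProperties joinSemilattice public using (∨-monotonic; x≤y⇒x∨y≈y)
  open MeetSemilatticeProperties meetSemilattice public using (∧-monotonic)
  open PosetReasoning poset

  𝟘-minimum : ∀ x → 𝟘 ≤ x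
  𝟘-minimum x = sym (𝟘-least x)

  𝟙-maximum : ∀ x → x ≤ 𝟙
  𝟙-maximum x = sym (𝟙-greatest x)

  transpose-⇒ : ∀ {x y z} → x ⊙ y ≤ z → x ≤ (y ⇒ z)
  transpose-⇒ {x} {y} {z} xy≤z = sym (residuation₁ x y z (sym xy≤z))

  transpose-⊙ : ∀ {x y z} → x ≤ (y ⇒ z) → x ⊙ y ≤ z
  transpose-⊙ {x} {y} {z} x≤y⇒z = sym (residuation₂ x y z (sym x≤y⇒z))

  ⇒-eval : ∀ {x y} → (x ⇒ y) ⊙ x ≤ y
  ⇒-eval = transpose-⊙ ≤-refl

  ⊙-monoˡ : ∀ {x y z} → x ≤ y → x ⊙ z ≤ y ⊙ z
  ⊙-monoˡ x≤y = transpose-⊙ (≤-trans x≤y (transpose-⇒ ≤-refl))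

  ⊙-monotonic : ∀ {x y u v} → x ≤ y → u ≤ v → x ⊙ u ≤ y ⊙ v
  ⊙-monotonic {x} {y} {u} {v} x≤y u≤v = begin
    x ⊙ u  ≤⟨ ⊙-monoˡ x≤y ⟩
    y ⊙ u  ≡⟨ ⊙-comm y u ⟩
    u ⊙ y  ≤⟨ ⊙-monoˡ u≤v ⟩
    v ⊙ y  ≡⟨ ⊙-comm v y ⟩
    y ⊙ v  ∎

  ⊙-distribʳ-∨ : ∀ x y z → (x ∨ y) ⊙ z ≡ x ⊙ z ∨ y ⊙ z
  ⊙-distribʳ-∨ x y z = ≤-antisym
    (transpose-⊙ (∨-least (transpose-⇒ (x≤x∨y _ _)) (transpose-⇒ (y≤x∨y _ _))))
    (∨-least (⊙-monoˡ (x≤x∨y x y)) (⊙-monoˡ (y≤x∨y x y)))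

  ⊙-distribˡ-∨ : ∀ x y z → x ⊙ (y ∨ z) ≡ x ⊙ y ∨ x ⊙ z
  ⊙-distribˡ-∨ x y z = begin-equality
    x ⊙ (y ∨ z)      ≡⟨ ⊙-comm x (y ∨ z) ⟩
    (y ∨ z) ⊙ x      ≡⟨ ⊙-distribʳ-∨ y z x ⟩
    y ⊙ x ∨ z ⊙ x    ≡⟨ cong₂ _∨_ (⊙-comm y x) (⊙-comm z x) ⟩
    x ⊙ y ∨ x ⊙ z    ∎

  ⊙-zeroˡ : ∀ x → 𝟘 ⊙ x ≡ 𝟘
  ⊙-zeroˡ x = ≤-antisym (transpose-⊙ (𝟘-minimum _)) (𝟘-minimum _)

  ⊙-zeroʳ : ∀ x → x ⊙ 𝟘 ≡ 𝟘
  ⊙-zeroʳ x = trans (⊙-comm x 𝟘) (⊙-zeroˡ x)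

  ⇒-antitoneˡ : ∀ {x y z} → x ≤ y → (y ⇒ z) ≤ (x ⇒ z)
  ⇒-antitoneˡ x≤y = transpose-⇒ (≤-trans (⊙-monotonic ≤-refl x≤y) ⇒-eval)

  ⇒-unit : ∀ x → (x ⇒ x) ≡ 𝟙
  ⇒-unit x = ≤-antisym (𝟙-maximum _) (transpose-⇒ (≤-reflexive (⊙-identityˡ x)))

  𝟙⇒x≤x : ∀ x → (𝟙 ⇒ x) ≤ x
  𝟙⇒x≤x x = begin
    𝟙 ⇒ x          ≡⟨ ⊙-identityʳ (𝟙 ⇒ x) ⟨
    (𝟙 ⇒ x) ⊙ 𝟙    ≤⟨ ⇒-eval ⟩
    x              ∎

  infix 5 _⇔_
  _⇔_ : Carrier → Carrier → Carrier
  x ⇔ y = (x ⇒ y) ⊙ (y ⇒ x)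

  ⇔-refl : ∀ x → x ⇔ x ≡ 𝟙
  ⇔-refl x = trans (cong₂ _⊙_ (⇒-unit x) (⇒-unit x)) (⊙-identityʳ 𝟙)

  𝟙≡𝟘⇒trivial : 𝟙 ≡ 𝟘 → Trivial A
  𝟙≡𝟘⇒trivial 𝟙≡𝟘 x y = trans (≡𝟘 x) (sym (≡𝟘 y))
    where
    ≡𝟘 : ∀ x → x ≡ 𝟘
    ≡𝟘 x = ≤-antisym (≤-trans (𝟙-maximum x) (≤-reflexive 𝟙≡𝟘)) (𝟘-minimum x)

idHom : ∀ {ℓ} {A : ResLattice ℓ} → Hom A A
idHom = record
  { ⟦_⟧ = λ x → x
  ; pres-∧ = λ _ _ → refl ; pres-∨ = λ _ _ → refl ; pres-⊙ = λ _ _ → refl ; pres-⇒ = λ _ _ → refl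
  ; pres-𝟘 = refl ; pres-𝟙 = refl
  }

pres-⇔ : ∀ {ℓ₁ ℓ₂} {A : ResLattice ℓ₁} {B : ResLattice ℓ₂} (f : Hom A B) →
  ∀ x y → ⟦ f ⟧ (Properties._⇔_ A x y) ≡ Properties._⇔_ B (⟦ f ⟧ x) (⟦ f ⟧ y)
pres-⇔ {B = B} f x y = trans (pres-⊙ f _ _) (cong₂ (ResLattice._⊙_ B) (pres-⇒ f x y) (pres-⇒ f y x))

injective⇒absoluteRetract : ∀ {ℓ} {K} {A : ResLattice ℓ} → A ∈ᵥ K → InjectiveIn K A → AbsoluteRetractIn K A
injective⇒absoluteRetract {A = A} A∈K injective B B∈K i i-injective =
  injective A B A∈K B∈K i i-injective idHom

module IntervalAlgebra {ℓ} (A : ResLattice ℓ) where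
  open ResLattice A hiding (_≤_)
  open Properties A

  record Interval : Set ℓ where
    constructor ⟨_,_,_⟩
    field
      lo hi : Carrier
      lo≤hi : lo ≤ hi
  open Interval

  interval-≡ : ∀ {x y} → lo x ≡ lo y → hi x ≡ hi y → x ≡ y
  interval-≡ {⟨ a , b , p ⟩} {⟨ .a , .b , q ⟩} refl refl rewrite uip p q = refl

  [_] : Carrier → Interval
  [ a ] = ⟨ a , a , ≤-refl ⟩

  infixr 7 _⊙ᴵ_
  infixr 6 _∧ᴵ_
  infixr 5 _∨ᴵ_
  infixr 4 _⇒ᴵ_

  _∧ᴵ_ _∨ᴵ_ _⊙ᴵ_ _⇒ᴵ_ : Interval → Interval → Interval
  ⟨ a , b , a≤b ⟩ ∧ᴵ ⟨ c , d , c≤d ⟩ = ⟨ a ∧ c , b ∧ d , ∧-monotonic a≤b c≤d ⟩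
  ⟨ a , b , a≤b ⟩ ∨ᴵ ⟨ c , d , c≤d ⟩ = ⟨ a ∨ c , b ∨ d , ∨-monotonic a≤b c≤d ⟩
  ⟨ a , b , _ ⟩ ⊙ᴵ ⟨ c , d , c≤d ⟩ =
    ⟨ a ⊙ c , a ⊙ d ∨ b ⊙ c , ≤-trans (⊙-monotonic ≤-refl c≤d) (x≤x∨y _ _) ⟩
  ⟨ a , b , a≤b ⟩ ⇒ᴵ ⟨ c , d , _ ⟩ =
    ⟨ (a ⇒ c) ∧ (b ⇒ d) , a ⇒ d , ≤-trans (x∧y≤y _ _) (⇒-antitoneˡ a≤b) ⟩

  𝟘ᴵ 𝟙ᴵ : Interval
  𝟘ᴵ = [ 𝟘 ]
  𝟙ᴵ = [ 𝟙 ]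

  infix 4 _⊑_
  _⊑_ : Interval → Interval → Set ℓ
  x ⊑ y = lo x ≤ lo y × hi x ≤ hi y

  ∧ᴵ-≡⇒⊑ : ∀ {x y} → x ∧ᴵ y ≡ x → x ⊑ y
  ∧ᴵ-≡⇒⊑ {⟨ _ , _ , _ ⟩} {⟨ _ , _ , _ ⟩} x∧y≡x = sym (cong lo x∧y≡x) , sym (cong hi x∧y≡x)

  ⊑⇒∧ᴵ-≡ : ∀ {x y} → x ⊑ y → x ∧ᴵ y ≡ x
  ⊑⇒∧ᴵ-≡ {⟨ _ , _ , _ ⟩} {⟨ _ , _ , _ ⟩} (lo≤ , hi≤) = interval-≡ (sym lo≤) (sym hi≤)

  transpose-⇒ᴵ : ∀ x y z → x ⊙ᴵ y ⊑ z → x ⊑ (y ⇒ᴵ z)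
  transpose-⇒ᴵ ⟨ a , b , _ ⟩ ⟨ c , d , _ ⟩ ⟨ e , f , _ ⟩ (ac≤e , ad∨bc≤f) =
    ∧-greatest (transpose-⇒ ac≤e) (transpose-⇒ (≤-trans (x≤x∨y _ _) ad∨bc≤f)) ,
    transpose-⇒ (≤-trans (y≤x∨y _ _) ad∨bc≤f)

  transpose-⊙ᴵ : ∀ x y z → x ⊑ (y ⇒ᴵ z) → x ⊙ᴵ y ⊑ z
  transpose-⊙ᴵ ⟨ a , b , _ ⟩ ⟨ c , d , _ ⟩ ⟨ e , f , _ ⟩ (a≤c⇒e∧d⇒f , b≤c⇒f) =
    transpose-⊙ (≤-trans a≤c⇒e∧d⇒f (x∧y≤x _ _)) ,
    ∨-least (transpose-⊙ (≤-trans a≤c⇒e∧d⇒f (x∧y≤y _ _))) (transpose-⊙ b≤c⇒f)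

  ⊙ᴵ-assoc : ∀ x y z → (x ⊙ᴵ y) ⊙ᴵ z ≡ x ⊙ᴵ (y ⊙ᴵ z)
  ⊙ᴵ-assoc ⟨ a , b , _ ⟩ ⟨ c , d , _ ⟩ ⟨ e , f , _ ⟩ = interval-≡ (⊙-assoc a c e) (begin
    (a ⊙ c) ⊙ f ∨ (a ⊙ d ∨ b ⊙ c) ⊙ e
      ≡⟨ cong₂ _∨_ (⊙-assoc a c f)
                   (trans (⊙-distribʳ-∨ (a ⊙ d) (b ⊙ c) e) (cong₂ _∨_ (⊙-assoc a d e) (⊙-assoc b c e))) ⟩
    a ⊙ (c ⊙ f) ∨ (a ⊙ (d ⊙ e) ∨ b ⊙ (c ⊙ e))
      ≡⟨ ∨-assoc _ _ _ ⟨
    (a ⊙ (c ⊙ f) ∨ a ⊙ (d ⊙ e)) ∨ b ⊙ (c ⊙ e)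
      ≡⟨ cong (_∨ b ⊙ (c ⊙ e)) (⊙-distribˡ-∨ a (c ⊙ f) (d ⊙ e)) ⟨
    a ⊙ (c ⊙ f ∨ d ⊙ e) ∨ b ⊙ (c ⊙ e) ∎)
    where open ≡-Reasoning

  ⊙ᴵ-comm : ∀ x y → x ⊙ᴵ y ≡ y ⊙ᴵ x
  ⊙ᴵ-comm ⟨ a , b , _ ⟩ ⟨ c , d , _ ⟩ =
    interval-≡ (⊙-comm a c) (trans (cong₂ _∨_ (⊙-comm a d) (⊙-comm b c)) (∨-comm (d ⊙ a) (c ⊙ b)))

  ⊙ᴵ-identityʳ : ∀ x → x ⊙ᴵ 𝟙ᴵ ≡ x
  ⊙ᴵ-identityʳ ⟨ a , b , a≤b ⟩ =
    interval-≡ (⊙-identityʳ a) (trans (cong₂ _∨_ (⊙-identityʳ a) (⊙-identityʳ b)) (x≤y⇒x∨y≈y a≤b))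

  Intervals : ResLattice ℓ
  Intervals = record
    { Carrier = Interval
    ; _∧_ = _∧ᴵ_ ; _∨_ = _∨ᴵ_ ; _⊙_ = _⊙ᴵ_ ; _⇒_ = _⇒ᴵ_ ; 𝟘 = 𝟘ᴵ ; 𝟙 = 𝟙ᴵ
    ; isCommutativeMonoid = record
      { isMonoid = record
        { isSemigroup = record
          { isMagma = record { isEquivalence = isEquivalence ; ∙-cong = cong₂ _⊙ᴵ_ }
          ; assoc = ⊙ᴵ-assoc
          }
        ; identity = (λ x → trans (⊙ᴵ-comm 𝟙ᴵ x) (⊙ᴵ-identityʳ x)) , ⊙ᴵ-identityʳ
        }
      ; comm = ⊙ᴵ-comm
      }
    ; isLattice = record
      { isEquivalence = isEquivalence
      ; ∨-comm = λ { ⟨ a , b , _ ⟩ ⟨ c , d , _ ⟩ → interval-≡ (∨-comm a c) (∨-comm b d) }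
      ; ∨-assoc = λ { ⟨ a , b , _ ⟩ ⟨ c , d , _ ⟩ ⟨ e , f , _ ⟩ → interval-≡ (∨-assoc a c e) (∨-assoc b d f) }
      ; ∨-cong = cong₂ _∨ᴵ_
      ; ∧-comm = λ { ⟨ a , b , _ ⟩ ⟨ c , d , _ ⟩ → interval-≡ (∧-comm a c) (∧-comm b d) }
      ; ∧-assoc = λ { ⟨ a , b , _ ⟩ ⟨ c , d , _ ⟩ ⟨ e , f , _ ⟩ → interval-≡ (∧-assoc a c e) (∧-assoc b d f) }
      ; ∧-cong = cong₂ _∧ᴵ_
      ; absorptive =
          (λ { ⟨ a , b , _ ⟩ ⟨ c , d , _ ⟩ → interval-≡ (∨-absorbs-∧ a c) (∨-absorbs-∧ b d) }) ,
          (λ { ⟨ a , b , _ ⟩ ⟨ c , d , _ ⟩ → interval-≡ (∧-absorbs-∨ a c) (∧-absorbs-∨ b d) })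
      }
    ; 𝟘-least = λ { ⟨ a , b , _ ⟩ → interval-≡ (𝟘-least a) (𝟘-least b) }
    ; 𝟙-greatest = λ { ⟨ a , b , _ ⟩ → interval-≡ (𝟙-greatest a) (𝟙-greatest b) }
    ; residuation₁ = λ x y z xy≤z → ⊑⇒∧ᴵ-≡ (transpose-⇒ᴵ x y z (∧ᴵ-≡⇒⊑ xy≤z))
    ; residuation₂ = λ x y z x≤y⇒z → ⊑⇒∧ᴵ-≡ (transpose-⊙ᴵ x y z (∧ᴵ-≡⇒⊑ x≤y⇒z))
    }

  diagonal : Hom A Intervals
  diagonal = record
    { ⟦_⟧ = [_]
    ; pres-∧ = λ _ _ → interval-≡ refl refl
    ; pres-∨ = λ _ _ → interval-≡ refl refl
    ; pres-⊙ = λ _ _ → interval-≡ refl (sym (∨-idem _))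
    ; pres-⇒ = λ _ _ → interval-≡ (sym (∧-idem _)) refl
    ; pres-𝟘 = refl
    ; pres-𝟙 = refl
    }

  diagonal-injective : IsInjectiveHom diagonal
  diagonal-injective = cong lo

  ¬ᴵ-swap : ∀ x → (x ⇒ᴵ 𝟘ᴵ) ≡ ⟨ ¬ hi x , ¬ lo x , ⇒-antitoneˡ (lo≤hi x) ⟩
  ¬ᴵ-swap ⟨ a , b , a≤b ⟩ = interval-≡ (trans (∧-comm (¬ a) (¬ b)) (sym (⇒-antitoneˡ a≤b))) refl

  Intervals-girard : IsGirard A → IsGirard Intervals
  Intervals-girard ¬¬-involutive x = begin
    (x ⇒ᴵ 𝟘ᴵ) ⇒ᴵ 𝟘ᴵ                                     ≡⟨ cong (_⇒ᴵ 𝟘ᴵ) (¬ᴵ-swap x) ⟩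
    ⟨ ¬ hi x , ¬ lo x , ⇒-antitoneˡ (lo≤hi x) ⟩ ⇒ᴵ 𝟘ᴵ   ≡⟨ ¬ᴵ-swap _ ⟩
    ⟨ ¬ ¬ lo x , ¬ ¬ hi x , _ ⟩                          ≡⟨ interval-≡ (¬¬-involutive (lo x)) (¬¬-involutive (hi x)) ⟩
    x                                                     ∎
    where open ≡-Reasoning

  Intervals-distributive : IsDistributive A → IsDistributive Intervals
  Intervals-distributive distrib ⟨ a , b , _ ⟩ ⟨ c , d , _ ⟩ ⟨ e , f , _ ⟩ =
    interval-≡ (distrib a c e) (distrib b d f)

  Intervals-∈ᵥ : ∀ K → A ∈ᵥ K → Intervals ∈ᵥ K
  Intervals-∈ᵥ RL  _                  = tt
  Intervals-∈ᵥ GM  girard             = Intervals-girard girard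
  Intervals-∈ᵥ DRL distrib            = Intervals-distributive distrib
  Intervals-∈ᵥ DGM (girard , distrib) = Intervals-girard girard , Intervals-distributive distrib

  open Properties Intervals using () renaming (_⇔_ to _⇔ᴵ_)

  unitInterval : Interval
  unitInterval = ⟨ 𝟘 , 𝟙 , 𝟘-minimum 𝟙 ⟩

  lo[unitInterval⇔ᴵ[a]]≡𝟘 : ∀ a → lo (unitInterval ⇔ᴵ [ a ]) ≡ 𝟘
  lo[unitInterval⇔ᴵ[a]]≡𝟘 a = ≤-antisym (begin
    ((𝟘 ⇒ a) ∧ (𝟙 ⇒ a)) ⊙ ((a ⇒ 𝟘) ∧ (a ⇒ 𝟙))  ≤⟨ ⊙-monotonic (x∧y≤y _ _) (x∧y≤x _ _) ⟩
    (𝟙 ⇒ a) ⊙ (a ⇒ 𝟘)                          ≤⟨ ⊙-monotonic (𝟙⇒x≤x a) ≤-refl ⟩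
    a ⊙ (a ⇒ 𝟘)                                ≡⟨ ⊙-comm a (a ⇒ 𝟘) ⟩
    (a ⇒ 𝟘) ⊙ a                                ≤⟨ ⇒-eval ⟩
    𝟘                                          ∎) (𝟘-minimum _)
    where open PosetReasoning poset

  lo≡𝟘⇒x⊙ᴵx≡𝟘ᴵ : ∀ x → lo x ≡ 𝟘 → x ⊙ᴵ x ≡ 𝟘ᴵ
  lo≡𝟘⇒x⊙ᴵx≡𝟘ᴵ ⟨ _ , b , _ ⟩ refl =
    interval-≡ (⊙-zeroˡ 𝟘) (trans (cong₂ _∨_ (⊙-zeroˡ b) (⊙-zeroʳ b)) (∨-idem 𝟘))

  retract-of-diagonal⇒trivial : (r : Hom Intervals A) → (∀ a → ⟦ r ⟧ [ a ] ≡ a) → Trivial A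
  retract-of-diagonal⇒trivial r r[a]≡a = 𝟙≡𝟘⇒trivial (begin
    𝟙                  ≡⟨ ⊙-identityʳ 𝟙 ⟨
    𝟙 ⊙ 𝟙              ≡⟨ cong₂ _⊙_ r[e]≡𝟙 r[e]≡𝟙 ⟨
    ⟦ r ⟧ e ⊙ ⟦ r ⟧ e  ≡⟨ pres-⊙ r e e ⟨
    ⟦ r ⟧ (e ⊙ᴵ e)     ≡⟨ cong ⟦ r ⟧ (lo≡𝟘⇒x⊙ᴵx≡𝟘ᴵ e (lo[unitInterval⇔ᴵ[a]]≡𝟘 a)) ⟩
    ⟦ r ⟧ 𝟘ᴵ           ≡⟨ pres-𝟘 r ⟩
    𝟘                  ∎)
    where
    open ≡-Reasoning
    a : Carrier
    a = ⟦ r ⟧ unitInterval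
    e : Interval
    e = unitInterval ⇔ᴵ [ a ]
    r[e]≡𝟙 : ⟦ r ⟧ e ≡ 𝟙
    r[e]≡𝟙 = begin
      ⟦ r ⟧ e          ≡⟨ pres-⇔ r unitInterval [ a ] ⟩
      a ⇔ ⟦ r ⟧ [ a ]  ≡⟨ cong (a ⇔_) (r[a]≡a a) ⟩
      a ⇔ a            ≡⟨ ⇔-refl a ⟩
      𝟙                ∎

absoluteRetract⇒trivial : ∀ {ℓ} K (A : ResLattice ℓ) → A ∈ᵥ K → AbsoluteRetractIn K A → Trivial A
absoluteRetract⇒trivial K A A∈K absoluteRetract =
  uncurry retract-of-diagonal⇒trivial
    (absoluteRetract Intervals (Intervals-∈ᵥ K A∈K) diagonal diagonal-injective)
  where open IntervalAlgebra A

corollary5p4 : ∀ {ℓ : Level} (K : Variety) (A : ResLattice ℓ) → A ∈ᵥ K →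
    (AbsoluteRetractIn K A → Trivial A) × (InjectiveIn K A → Trivial A)
corollary5p4 K A A∈K =
  absoluteRetract⇒trivial K A A∈K ,
  λ injective → absoluteRetract⇒trivial K A A∈K (injective⇒absoluteRetract A∈K injective)
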